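{- For every term $t$ of $\mathsf{L}_{\mathrm{foc}}$ built without explicit substitutions (a command, value, expression or context), $t^*=_{\beta\eta}(t_{\mathsf{LLP}})_{\mathsf{NJ}}$, where $(\cdot)^*$, $(\cdot)_{\mathsf{LLP}}$ and $(\cdot)_{\mathsf{NJ}}$ are the translations described below.
   Context: $\mathsf{L}_{\mathrm{foc}}$ terms (without explicit substitutions): commands $c::=\langle v|e\rangle$; expressions $v::=\widehat V\mid\mu\alpha.c$; values $V::=x\mid(V,V)\mid\mathrm{inl}(V)\mid\mathrm{inr}(V)\mid e^\bullet$; contexts $e::=\alpha\mid\tilde\mu x.c\mid\tilde\mu\alpha^\bullet.c\mid\tilde\mu(x_1,x_2).c\mid\tilde\mu[\mathrm{inl}(x_1).c_1|\mathrm{inr}(x_2).c_2]$. Translation $(\cdot)^*$ into $\lambda$-calculus with pairs and sums ($k_\alpha$ a variable associated to $\alpha$): $\langle v|e\rangle^*=v^*e^*$; $(\widehat V)^*=\lambda k.kV^*$; $(\mu\alpha.c)^*=\lambda k_\alpha.c^*=(\tilde\mu\alpha^\bullet.c)^*$; $x^*=x$; $(V_1,V_2)^*=(V_1^*,V_2^*)$; $\mathrm{inl}(V)^*=\mathrm{inl}(V^*)$; $\mathrm{inr}(V)^*=\mathrm{inr}(V^*)$; $(e^\bullet)^*=e^*$; $\alpha^*=k_\alpha$; $(\tilde\mu x.c)^*=\lambda x.c^*$; $(\tilde\mu(x_1,x_2).c)^*=\lambda(x_1,x_2).c^*$; $(\tilde\mu[\mathrm{inl}(x_1).c_1|\mathrm{inr}(x_2).c_2])^*=\lambda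 z.\mathrm{case}\ z\ \mathrm{of}\ \mathrm{inl}(x_1)\mapsto c_1^*,\mathrm{inr}(x_2)\mapsto c_2^*$. Target subsystem of $\mathsf{LLP}$, with syntax $c::=\langle V|e\rangle$, $V::=x\mid e^\bullet\mid(V,V)\mid\mathrm{inl}(V)\mid\mathrm{inr}(V)$, $e::=\mathrm{der}(V)\mid\tilde\mu x.c\mid\tilde\mu(x_1,x_2).c\mid\tilde\mu[\mathrm{inl}(x_1).c_1|\mathrm{inr}(x_2).c_2]$ (where $e^\bullet$ is promotion and $\mathrm{der}(V)$ dereliction); continuation variables $\alpha$ become ordinary variables $k_\alpha$. Translation $(\cdot)_{\mathsf{LLP}}$: $\langle v|e\rangle_{\mathsf{LLP}}=\langle(e_{\mathsf{LLP}})^\bullet|v_{\mathsf{LLP}}\rangle$; $(\mu\alpha.c)_{\mathsf{LLP}}=\tilde\mu k_\alpha.c_{\mathsf{LLP}}$; $(\widehat V)_{\mathsf{LLP}}=\mathrm{der}(V_{\mathsf{LLP}})$; $\alpha_{\mathsf{LLP}}=\tilde\mu x.\langle k_\alpha|\mathrm{der}(x)\rangle$; $(\tilde\mu\alpha^\bullet.c)_{\mathsf{LLP}}=\tilde\mu k_\alpha.c_{\mathsf{LLP}}$; and homomorphically on the other constructs: $x_{\mathsf{LLP}}=x$, $(V_1,V_2)_{\mathsf{LLP}}=((V_1)_{\mathsf{LLP}},(V_2)_{\mathsf{LLP}})$, $\mathrm{inl}/\mathrm{inr}$ likewise, $(e^\bullet)_{\mathsf{LLP}}=(e_{\mathsf{LLP}})^\bullet$,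 $(\tilde\mu x.c)_{\mathsf{LLP}}=\tilde\mu x.c_{\mathsf{LLP}}$, $(\tilde\mu(x_1,x_2).c)_{\mathsf{LLP}}=\tilde\mu(x_1,x_2).c_{\mathsf{LLP}}$, $(\tilde\mu[\mathrm{inl}(x_1).c_1|\mathrm{inr}(x_2).c_2])_{\mathsf{LLP}}=\tilde\mu[\mathrm{inl}(x_1).(c_1)_{\mathsf{LLP}}|\mathrm{inr}(x_2).(c_2)_{\mathsf{LLP}}]$. Translation $(\cdot)_{\mathsf{NJ}}$ from this $\mathsf{LLP}$ syntax into $\lambda$-calculus: $\langle V|e\rangle_{\mathsf{NJ}}=e_{\mathsf{NJ}}V_{\mathsf{NJ}}$; $(e^\bullet)_{\mathsf{NJ}}=e_{\mathsf{NJ}}$; $(\mathrm{der}(V))_{\mathsf{NJ}}=\lambda k.kV_{\mathsf{NJ}}$; $(\tilde\mu x.c)_{\mathsf{NJ}}=\lambda x.c_{\mathsf{NJ}}$; $(\tilde\mu(x_1,x_2).c)_{\mathsf{NJ}}=\lambda(x_1,x_2).c_{\mathsf{NJ}}$; $(\tilde\mu[\mathrm{inl}(x_1).c_1|\mathrm{inr}(x_2).c_2])_{\mathsf{NJ}}=\lambda z.\mathrm{case}\ z\ \mathrm{of}\ \mathrm{inl}(x_1)\mapsto(c_1)_{\mathsf{NJ}},\mathrm{inr}(x_2)\mapsto(c_2)_{\mathsf{NJ}}$; homomorphic on variables, pairs and injections. $=_{\beta\eta}$ is $\beta\eta$-equality of the $\lambda$-calculus. -}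

module Defs where

open import Data.Nat using (ℕ; zero; suc)
open import Data.Fin using (Fin; zero; suc)
open import Data.List using (List; []; _∷_; length)

-- Scoping for L_foc: two sorts of variables, value variables x and
-- continuation variables α.  Terms are well-scoped (de Bruijn).

data Kind : Set where
  val : Kind
  cov : Kind

data _∋_ : List Kind → Kind → Set where
  here  : ∀ {Γ k} → (k ∷ Γ) ∋ k
  there : ∀ {Γ k k'} → Γ ∋ k → (k' ∷ Γ) ∋ k

-- position of a variable; used when x and α (as k_α) become ordinary variables
toFin : ∀ {Γ k} → Γ ∋ k → Fin (length Γ)
toFin here      = zero
toFin (there i) = suc (toFin i)

-- L_foc without explicit substitutions.
-- Binder convention for (x1,x2): x1 is bound first, so x2 is index 0.

data FCmd  (Γ : List Kind) : Set
data FExpr (Γ : List Kind) : Set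
data FVal  (Γ : List Kind) : Set
data FCtx  (Γ : List Kind) : Set

data FCmd Γ where
  ⟨_∣_⟩ᶠ : FExpr Γ → FCtx Γ → FCmd Γ

data FExpr Γ where
  fret : FVal Γ → FExpr Γ
  fμ   : FCmd (cov ∷ Γ) → FExpr Γ

data FVal Γ where
  fvar  : Γ ∋ val → FVal Γ
  fpair : FVal Γ → FVal Γ → FVal Γ
  finl  : FVal Γ → FVal Γ
  finr  : FVal Γ → FVal Γ
  fbox  : FCtx Γ → FVal Γ

data FCtx Γ where
  fcovar : Γ ∋ cov → FCtx Γ
  fμ̃     : FCmd (val ∷ Γ) → FCtx Γ
  fμ̃•    : FCmd (cov ∷ Γ) → FCtx Γ
  fμ̃pair : FCmd (val ∷ val ∷ Γ) → FCtx Γ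
  fμ̃case : FCmd (val ∷ Γ) → FCmd (val ∷ Γ) → FCtx Γ

data Tm (n : ℕ) : Set where
  var     : Fin n → Tm n
  lam     : Tm (suc n) → Tm n
  _·_     : Tm n → Tm n → Tm n
  pair    : Tm n → Tm n → Tm n
  inl     : Tm n → Tm n
  inr     : Tm n → Tm n
  lamPair : Tm (suc (suc n)) → Tm n
  case    : Tm n → Tm (suc n) → Tm (suc n) → Tm n

infixl 7 _·_

ext : ∀ {n m} → (Fin n → Fin m) → Fin (suc n) → Fin (suc m)
ext ρ zero    = zero
ext ρ (suc i) = suc (ρ i)

ren : ∀ {n m} → (Fin n → Fin m) → Tm n → Tm m
ren ρ (var i)       = var (ρ i)
ren ρ (lam t)       = lam (ren (ext ρ) t)
ren ρ (t · u)       = ren ρ t · ren ρ u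
ren ρ (pair t u)    = pair (ren ρ t) (ren ρ u)
ren ρ (inl t)       = inl (ren ρ t)
ren ρ (inr t)       = inr (ren ρ t)
ren ρ (lamPair t)   = lamPair (ren (ext (ext ρ)) t)
ren ρ (case t u w)  = case (ren ρ t) (ren (ext ρ) u) (ren (ext ρ) w)

exts : ∀ {n m} → (Fin n → Tm m) → Fin (suc n) → Tm (suc m)
exts σ zero    = var zero
exts σ (suc i) = ren suc (σ i)

sub : ∀ {n m} → (Fin n → Tm m) → Tm n → Tm m
sub σ (var i)       = σ i
sub σ (lam t)       = lam (sub (exts σ) t)
sub σ (t · u)       = sub σ t · sub σ u
sub σ (pair t u)    = pair (sub σ t) (sub σ u)
sub σ (inl t)       = inl (sub σ t)
sub σ (inr t)       = inr (sub σ t)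
sub σ (lamPair t)   = lamPair (sub (exts (exts σ)) t)
sub σ (case t u w)  = case (sub σ t) (sub (exts σ) u) (sub (exts σ) w)

sub1 : ∀ {n} → Tm n → Fin (suc n) → Tm n
sub1 u zero    = u
sub1 u (suc i) = var i

-- x1 ↦ u1 (index 1), x2 ↦ u2 (index 0)
sub2 : ∀ {n} → Tm n → Tm n → Fin (suc (suc n)) → Tm n
sub2 u1 u2 zero          = u2
sub2 u1 u2 (suc zero)    = u1
sub2 u1 u2 (suc (suc i)) = var i

infix 4 _=βη_
data _=βη_ {n : ℕ} : Tm n → Tm n → Set where
  ≈refl  : ∀ {t} → t =βη t
  ≈sym   : ∀ {t u} → t =βη u → u =βη t
  ≈trans : ∀ {t u w} → t =βη u → u =βη w → t =βη w
  c-lam  : ∀ {t t'} → t =βη t' → lam t =βη lam t'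
  c-app  : ∀ {t t' u u'} → t =βη t' → u =βη u' → t · u =βη t' · u'
  c-pair : ∀ {t t' u u'} → t =βη t' → u =βη u' → pair t u =βη pair t' u'
  c-inl  : ∀ {t t'} → t =βη t' → inl t =βη inl t'
  c-inr  : ∀ {t t'} → t =βη t' → inr t =βη inr t'
  c-lamPair : ∀ {t t'} → t =βη t' → lamPair t =βη lamPair t'
  c-case : ∀ {t t' u u' w w'} → t =βη t' → u =βη u' → w =βη w' →
           case t u w =βη case t' u' w'
  β      : ∀ {t u} → lam t · u =βη sub (sub1 u) t
  βpair  : ∀ {t u1 u2} → lamPair t · pair u1 u2 =βη sub (sub2 u1 u2) t
  βinl   : ∀ {u t1 t2} → case (inl u) t1 t2 =βη sub (sub1 u) t1
  βinr   : ∀ {u t1 t2} → case (inr u) t1 t2 =βη sub (sub1 u) t2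
  η      : ∀ {t} → lam (ren suc t · var zero) =βη t

-- Target subsystem of LLP (only ordinary variables, k_α included).

data LCmd (n : ℕ) : Set
data LVal (n : ℕ) : Set
data LCtx (n : ℕ) : Set

data LCmd n where
  ⟨_∣_⟩ˡ : LVal n → LCtx n → LCmd n

data LVal n where
  lvar  : Fin n → LVal n
  lprom : LCtx n → LVal n
  lpair : LVal n → LVal n → LVal n
  linl  : LVal n → LVal n
  linr  : LVal n → LVal n

data LCtx n where
  lder   : LVal n → LCtx n
  lμ̃     : LCmd (suc n) → LCtx n
  lμ̃pair : LCmd (suc (suc n)) → LCtx n
  lμ̃case : LCmd (suc n) → LCmd (suc n) → LCtx n

cmd*  : ∀ {Γ} → FCmd Γ → Tm (length Γ)
expr* : ∀ {Γ} → FExpr Γ → Tm (length Γ)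
val*  : ∀ {Γ} → FVal Γ → Tm (length Γ)
ctx*  : ∀ {Γ} → FCtx Γ → Tm (length Γ)

cmd* ⟨ v ∣ e ⟩ᶠ = expr* v · ctx* e

expr* (fret V) = lam (var zero · ren suc (val* V))
expr* (fμ c)   = lam (cmd* c)

val* (fvar i)    = var (toFin i)
val* (fpair V W) = pair (val* V) (val* W)
val* (finl V)    = inl (val* V)
val* (finr V)    = inr (val* V)
val* (fbox e)    = ctx* e

ctx* (fcovar a)     = var (toFin a)
ctx* (fμ̃ c)         = lam (cmd* c)
ctx* (fμ̃• c)        = lam (cmd* c)
ctx* (fμ̃pair c)     = lamPair (cmd* c)
ctx* (fμ̃case c1 c2) = lam (case (var zero) (ren (ext suc) (cmd* c1)) (ren (ext suc) (cmd* c2)))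

cmdL  : ∀ {Γ} → FCmd Γ → LCmd (length Γ)
exprL : ∀ {Γ} → FExpr Γ → LCtx (length Γ)
valL  : ∀ {Γ} → FVal Γ → LVal (length Γ)
ctxL  : ∀ {Γ} → FCtx Γ → LCtx (length Γ)

cmdL ⟨ v ∣ e ⟩ᶠ = ⟨ lprom (ctxL e) ∣ exprL v ⟩ˡ

exprL (fret V) = lder (valL V)
exprL (fμ c)   = lμ̃ (cmdL c)

valL (fvar i)    = lvar (toFin i)
valL (fpair V W) = lpair (valL V) (valL W)
valL (finl V)    = linl (valL V)
valL (finr V)    = linr (valL V)
valL (fbox e)    = lprom (ctxL e)

-- α_LLP = μ̃x.⟨k_α | der(x)⟩
ctxL (fcovar a)     = lμ̃ ⟨ lvar (suc (toFin a)) ∣ lder (lvar zero) ⟩ˡ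
ctxL (fμ̃ c)         = lμ̃ (cmdL c)
ctxL (fμ̃• c)        = lμ̃ (cmdL c)
ctxL (fμ̃pair c)     = lμ̃pair (cmdL c)
ctxL (fμ̃case c1 c2) = lμ̃case (cmdL c1) (cmdL c2)

cmdNJ : ∀ {n} → LCmd n → Tm n
valNJ : ∀ {n} → LVal n → Tm n
ctxNJ : ∀ {n} → LCtx n → Tm n

cmdNJ ⟨ V ∣ e ⟩ˡ = ctxNJ e · valNJ V

valNJ (lvar i)    = var i
valNJ (lprom e)   = ctxNJ e
valNJ (lpair V W) = pair (valNJ V) (valNJ W)
valNJ (linl V)    = inl (valNJ V)
valNJ (linr V)    = inr (valNJ V)

ctxNJ (lder V)       = lam (var zero · ren suc (valNJ V))
ctxNJ (lμ̃ c)         = lam (cmdNJ c)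
ctxNJ (lμ̃pair c)     = lamPair (cmdNJ c)
ctxNJ (lμ̃case c1 c2) = lam (case (var zero) (ren (ext suc) (cmdNJ c1)) (ren (ext suc) (cmdNJ c2)))

module Submission where

-- The two routes from L_foc to the λ-calculus, directly via (·)* and
-- through LLP via (·)_NJ ∘ (·)_LLP, agree syntactically on every
-- construct except covariables: α* = k_α, whereas (α_LLP)_NJ is the
-- β-redex λx.(λk.k x) k_α, which is k_α after one β- and one η-step.
-- The other difference is inessential: both translations weaken their
-- subterms (ren suc, ren (ext suc)) in the same way, so the inductive
-- hypothesis has to be transported along renamings.

open import Defs
open import Data.List using (List)
open import Data.Product using (_×_; _,_)
open import Data.Nat as ℕ using ()
open import Data.Fin using (Fin; zero; suc)
open import Relation.Binary.PropositionalEquality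
  using (_≡_; refl; sym; trans; cong; cong₂; subst)

cong-case : ∀ {n} {t t' : Tm n} {u u' w w'} →
            t ≡ t' → u ≡ u' → w ≡ w' → case t u w ≡ case t' u' w'
cong-case refl refl refl = refl

ext-fusion : ∀ {n m k} {f : Fin m → Fin k} {g : Fin n → Fin m} {h : Fin n → Fin k} →
             (∀ i → f (g i) ≡ h i) → ∀ i → ext f (ext g i) ≡ ext h i
ext-fusion fg≡h zero    = refl
ext-fusion fg≡h (suc i) = cong suc (fg≡h i)

ren-fusion : ∀ {n m k} {f : Fin m → Fin k} {g : Fin n → Fin m} {h : Fin n → Fin k} →
             (∀ i → f (g i) ≡ h i) → ∀ t → ren f (ren g t) ≡ ren h t
ren-fusion fg≡h (var i)      = cong var (fg≡h i)
ren-fusion fg≡h (lam t)      = cong lam (ren-fusion (ext-fusion fg≡h) t)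
ren-fusion fg≡h (t · u)      = cong₂ _·_ (ren-fusion fg≡h t) (ren-fusion fg≡h u)
ren-fusion fg≡h (pair t u)   = cong₂ pair (ren-fusion fg≡h t) (ren-fusion fg≡h u)
ren-fusion fg≡h (inl t)      = cong inl (ren-fusion fg≡h t)
ren-fusion fg≡h (inr t)      = cong inr (ren-fusion fg≡h t)
ren-fusion fg≡h (lamPair t)  = cong lamPair (ren-fusion (ext-fusion (ext-fusion fg≡h)) t)
ren-fusion fg≡h (case t u w) =
  cong-case (ren-fusion fg≡h t) (ren-fusion (ext-fusion fg≡h) u) (ren-fusion (ext-fusion fg≡h) w)

ren-weaken : ∀ {n m} (ρ : Fin n → Fin m) (t : Tm n) →
             ren (ext ρ) (ren suc t) ≡ ren suc (ren ρ t)
ren-weaken ρ t = trans (ren-fusion (λ _ → refl) t) (sym (ren-fusion (λ _ → refl) t))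

exts-ext : ∀ {n m k} {σ : Fin m → Tm k} {ρ : Fin n → Fin m} {τ : Fin n → Tm k} →
           (∀ i → σ (ρ i) ≡ τ i) → ∀ i → exts σ (ext ρ i) ≡ exts τ i
exts-ext σρ≡τ zero    = refl
exts-ext σρ≡τ (suc i) = cong (ren suc) (σρ≡τ i)

sub-ren : ∀ {n m k} {σ : Fin m → Tm k} {ρ : Fin n → Fin m} {τ : Fin n → Tm k} →
          (∀ i → σ (ρ i) ≡ τ i) → ∀ t → sub σ (ren ρ t) ≡ sub τ t
sub-ren σρ≡τ (var i)      = σρ≡τ i
sub-ren σρ≡τ (lam t)      = cong lam (sub-ren (exts-ext σρ≡τ) t)
sub-ren σρ≡τ (t · u)      = cong₂ _·_ (sub-ren σρ≡τ t) (sub-ren σρ≡τ u)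
sub-ren σρ≡τ (pair t u)   = cong₂ pair (sub-ren σρ≡τ t) (sub-ren σρ≡τ u)
sub-ren σρ≡τ (inl t)      = cong inl (sub-ren σρ≡τ t)
sub-ren σρ≡τ (inr t)      = cong inr (sub-ren σρ≡τ t)
sub-ren σρ≡τ (lamPair t)  = cong lamPair (sub-ren (exts-ext (exts-ext σρ≡τ)) t)
sub-ren σρ≡τ (case t u w) =
  cong-case (sub-ren σρ≡τ t) (sub-ren (exts-ext σρ≡τ) u) (sub-ren (exts-ext σρ≡τ) w)

ext-exts : ∀ {n m k} {ρ : Fin m → Fin k} {σ : Fin n → Tm m} {τ : Fin n → Tm k} →
           (∀ i → ren ρ (σ i) ≡ τ i) → ∀ i → ren (ext ρ) (exts σ i) ≡ exts τ i
ext-exts ρσ≡τ zero    = refl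
ext-exts {ρ = ρ} {σ} ρσ≡τ (suc i) = trans (ren-weaken ρ (σ i)) (cong (ren suc) (ρσ≡τ i))

ren-sub : ∀ {n m k} {ρ : Fin m → Fin k} {σ : Fin n → Tm m} {τ : Fin n → Tm k} →
          (∀ i → ren ρ (σ i) ≡ τ i) → ∀ t → ren ρ (sub σ t) ≡ sub τ t
ren-sub ρσ≡τ (var i)      = ρσ≡τ i
ren-sub ρσ≡τ (lam t)      = cong lam (ren-sub (ext-exts ρσ≡τ) t)
ren-sub ρσ≡τ (t · u)      = cong₂ _·_ (ren-sub ρσ≡τ t) (ren-sub ρσ≡τ u)
ren-sub ρσ≡τ (pair t u)   = cong₂ pair (ren-sub ρσ≡τ t) (ren-sub ρσ≡τ u)
ren-sub ρσ≡τ (inl t)      = cong inl (ren-sub ρσ≡τ t)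
ren-sub ρσ≡τ (inr t)      = cong inr (ren-sub ρσ≡τ t)
ren-sub ρσ≡τ (lamPair t)  = cong lamPair (ren-sub (ext-exts (ext-exts ρσ≡τ)) t)
ren-sub ρσ≡τ (case t u w) =
  cong-case (ren-sub ρσ≡τ t) (ren-sub (ext-exts ρσ≡τ) u) (ren-sub (ext-exts ρσ≡τ) w)

ren-sub1 : ∀ {n m} (ρ : Fin n → Fin m) (u : Tm n) (t : Tm (ℕ.suc n)) →
           ren ρ (sub (sub1 u) t) ≡ sub (sub1 (ren ρ u)) (ren (ext ρ) t)
ren-sub1 ρ u t = trans (ren-sub (λ _ → refl) t) (sym (sub-ren commutes t))
  where
  commutes : ∀ i → sub1 (ren ρ u) (ext ρ i) ≡ ren ρ (sub1 u i)
  commutes zero    = refl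
  commutes (suc i) = refl

ren-sub2 : ∀ {n m} (ρ : Fin n → Fin m) (u₁ u₂ : Tm n) (t : Tm (ℕ.suc (ℕ.suc n))) →
           ren ρ (sub (sub2 u₁ u₂) t) ≡ sub (sub2 (ren ρ u₁) (ren ρ u₂)) (ren (ext (ext ρ)) t)
ren-sub2 ρ u₁ u₂ t = trans (ren-sub (λ _ → refl) t) (sym (sub-ren commutes t))
  where
  commutes : ∀ i → sub2 (ren ρ u₁) (ren ρ u₂) (ext (ext ρ) i) ≡ ren ρ (sub2 u₁ u₂ i)
  commutes zero          = refl
  commutes (suc zero)    = refl
  commutes (suc (suc i)) = refl

ren-βη : ∀ {n m} (ρ : Fin n → Fin m) {t u : Tm n} → t =βη u → ren ρ t =βη ren ρ u
ren-βη ρ ≈refl              = ≈refl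
ren-βη ρ (≈sym p)           = ≈sym (ren-βη ρ p)
ren-βη ρ (≈trans p q)       = ≈trans (ren-βη ρ p) (ren-βη ρ q)
ren-βη ρ (c-lam p)          = c-lam (ren-βη (ext ρ) p)
ren-βη ρ (c-app p q)        = c-app (ren-βη ρ p) (ren-βη ρ q)
ren-βη ρ (c-pair p q)       = c-pair (ren-βη ρ p) (ren-βη ρ q)
ren-βη ρ (c-inl p)          = c-inl (ren-βη ρ p)
ren-βη ρ (c-inr p)          = c-inr (ren-βη ρ p)
ren-βη ρ (c-lamPair p)      = c-lamPair (ren-βη (ext (ext ρ)) p)
ren-βη ρ (c-case p q r)     = c-case (ren-βη ρ p) (ren-βη (ext ρ) q) (ren-βη (ext ρ) r)
ren-βη ρ (β {t} {u}) =
  subst (ren ρ (lam t · u) =βη_) (sym (ren-sub1 ρ u t)) β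
ren-βη ρ (βpair {t} {u₁} {u₂}) =
  subst (ren ρ (lamPair t · pair u₁ u₂) =βη_) (sym (ren-sub2 ρ u₁ u₂ t)) βpair
ren-βη ρ (βinl {u} {t₁} {t₂}) =
  subst (ren ρ (case (inl u) t₁ t₂) =βη_) (sym (ren-sub1 ρ u t₁)) βinl
ren-βη ρ (βinr {u} {t₁} {t₂}) =
  subst (ren ρ (case (inr u) t₁ t₂) =βη_) (sym (ren-sub1 ρ u t₂)) βinr
ren-βη ρ (η {t})            =
  subst (λ s → lam (s · var zero) =βη ren ρ t) (sym (ren-weaken ρ t)) η

-- A term used as a continuation is βη-equal to its expansion λx.(λk.k x) t,
-- which is how (·)_NJ ∘ (·)_LLP renders a covariable α.
continuation-expansion : ∀ {n} (t : Tm n) →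
                         lam (lam (var zero · var (suc zero)) · ren suc t) =βη t
continuation-expansion t = ≈trans (c-lam β) η

cmd-agrees  : ∀ {Γ} (c : FCmd Γ)  → cmd* c  =βη cmdNJ (cmdL c)
expr-agrees : ∀ {Γ} (v : FExpr Γ) → expr* v =βη ctxNJ (exprL v)
val-agrees  : ∀ {Γ} (V : FVal Γ)  → val* V  =βη valNJ (valL V)
ctx-agrees  : ∀ {Γ} (e : FCtx Γ)  → ctx* e  =βη ctxNJ (ctxL e)

cmd-agrees ⟨ v ∣ e ⟩ᶠ = c-app (expr-agrees v) (ctx-agrees e)

expr-agrees (fret V) = c-lam (c-app ≈refl (ren-βη suc (val-agrees V)))
expr-agrees (fμ c)   = c-lam (cmd-agrees c)

val-agrees (fvar x)    = ≈refl
val-agrees (fpair V W) = c-pair (val-agrees V) (val-agrees W)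
val-agrees (finl V)    = c-inl (val-agrees V)
val-agrees (finr V)    = c-inr (val-agrees V)
val-agrees (fbox e)    = ctx-agrees e

ctx-agrees (fcovar α)     = ≈sym (continuation-expansion (var (toFin α)))
ctx-agrees (fμ̃ c)         = c-lam (cmd-agrees c)
ctx-agrees (fμ̃• c)        = c-lam (cmd-agrees c)
ctx-agrees (fμ̃pair c)     = c-lamPair (cmd-agrees c)
ctx-agrees (fμ̃case c₁ c₂) =
  c-lam (c-case ≈refl (ren-βη (ext suc) (cmd-agrees c₁)) (ren-βη (ext suc) (cmd-agrees c₂)))

proposition4 : ((Γ : List Kind) (c : FCmd Γ) → cmd* c =βη cmdNJ (cmdL c))
               × ((Γ : List Kind) (v : FExpr Γ) → expr* v =βη ctxNJ (exprL v))
               × ((Γ : List Kind) (V : FVal Γ) → val* V =βη valNJ (valL V))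
               × ((Γ : List Kind) (e : FCtx Γ) → ctx* e =βη ctxNJ (ctxL e))
proposition4 = (λ _ → cmd-agrees) , (λ _ → expr-agrees) , (λ _ → val-agrees) , (λ _ → ctx-agrees)
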